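{- Let $\mathcal{A}$ be a DMF-algebra such that the interval $\nabla=[n,1]$, with the meet and join of $\mathcal{A}$, bottom $n$ and top $1$, is a Boolean algebra (i.e. is complemented). Then every partial valuation $\overline{v}$ on $\mathcal{A}$ is isotone: $a\le b$ implies $\overline{v}(a)\preccurlyeq\overline{v}(b)$ for all $a,b\in A$.
   Context: A DMF-algebra is an algebra $(A,\wedge,\vee,\lnot,0,1,n)$ such that $(A,\wedge,\vee,0,1)$ is a bounded distributive lattice, $\lnot\lnot x=x$, $\lnot(x\wedge y)=\lnot x\vee\lnot y$, $x\wedge\lnot x\le y\vee\lnot y$, and $\lnot n=n$. Let $T=\{(x,y)\in[0,1]^2:x+y\le1\}$ with $(x,y)\preccurlyeq(w,z)$ iff $x\le w$ and $z\le y$, pair arithmetic componentwise, $\sigma(x,y)=(y,x)$. A partial valuation on $\mathcal{A}$ is $\overline{v}:A\to T$ with $\overline{v}(0)=(0,1)$, $\overline{v}(a\vee b)=\overline{v}(a)+\overline{v}(b)-\overline{v}(a\wedge b)$, $\overline{v}(\lnot a)=\sigma(\overline{v}(a))$, and $n\le a\Rightarrow(0,0)\preccurlyeq\overline{v}(a)$. -}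

module Defs where

open import Level using (0ℓ)
open import Data.Product using (Σ; _×_; _,_; proj₁; proj₂; ∃)
open import Relation.Binary.PropositionalEquality using (_≡_)
open import Relation.Binary.Structures using (IsTotalOrder)
open import Relation.Nullary using (¬_)
open import Algebra.Structures using (IsCommutativeRing)
import Algebra.Lattice.Structures as LS

record DMFAlgebra : Set₁ where
  field
    Carrier : Set
    _∧_ _∨_ : Carrier → Carrier → Carrier
    ∼       : Carrier → Carrier
    𝟘 𝟙 n   : Carrier
    isDistributiveLattice : LS.IsDistributiveLattice _≡_ _∨_ _∧_
    ∨-identityʳ : ∀ x → (x ∨ 𝟘) ≡ x
    ∧-identityʳ : ∀ x → (x ∧ 𝟙) ≡ x
    ∼-involutive : ∀ x → ∼ (∼ x) ≡ x
    ∼-deMorgan   : ∀ x y → ∼ (x ∧ y) ≡ (∼ x ∨ ∼ y)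
  _≤_ : Carrier → Carrier → Set
  x ≤ y = (x ∧ y) ≡ x
  field
    kleene : ∀ x y → (x ∧ ∼ x) ≤ (y ∨ ∼ y)
    ∼n≡n   : ∼ n ≡ n

IntervalBoolean : DMFAlgebra → Set
IntervalBoolean 𝒜 =
  ∀ a → n ≤ a → Σ Carrier λ b → n ≤ b × ((a ∧ b) ≡ n) × ((a ∨ b) ≡ 𝟙)
  where open DMFAlgebra 𝒜

-- The real numbers, axiomatised as a Dedekind-complete ordered field
-- (any model is isomorphic to ℝ).

record RealNumbers : Set₁ where
  field
    ℝ : Set
    _+_ _*_ : ℝ → ℝ → ℝ
    -_ : ℝ → ℝ
    0ℝ 1ℝ : ℝ
    _≤_ : ℝ → ℝ → Set
    isCommutativeRing : IsCommutativeRing _≡_ _+_ _*_ -_ 0ℝ 1ℝ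
    0≢1 : ¬ (0ℝ ≡ 1ℝ)
    inverse : ∀ x → ¬ (x ≡ 0ℝ) → Σ ℝ λ y → (x * y) ≡ 1ℝ
    isTotalOrder : IsTotalOrder _≡_ _≤_
    +-mono-≤ : ∀ x y z → x ≤ y → (x + z) ≤ (y + z)
    *-nonneg : ∀ x y → 0ℝ ≤ x → 0ℝ ≤ y → 0ℝ ≤ (x * y)
    complete : (P : ℝ → Set) → Σ ℝ P → Σ ℝ (λ u → ∀ x → P x → x ≤ u) →
               Σ ℝ λ s → (∀ x → P x → x ≤ s) ×
                         (∀ u → (∀ x → P x → x ≤ u) → s ≤ u)
  _-_ : ℝ → ℝ → ℝ
  x - y = x + (- y)

module Pairs (Rℝ : RealNumbers) where
  open RealNumbers Rℝ

  InT : ℝ × ℝ → Set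
  InT (x , y) = (0ℝ ≤ x) × (x ≤ 1ℝ) × (0ℝ ≤ y) × (y ≤ 1ℝ) × ((x + y) ≤ 1ℝ)

  _≼_ : ℝ × ℝ → ℝ × ℝ → Set
  (x , y) ≼ (w , z) = (x ≤ w) × (z ≤ y)

  _⊕_ : ℝ × ℝ → ℝ × ℝ → ℝ × ℝ
  (x , y) ⊕ (w , z) = (x + w , y + z)

  _⊖_ : ℝ × ℝ → ℝ × ℝ → ℝ × ℝ
  (x , y) ⊖ (w , z) = (x - w , y - z)

  σ : ℝ × ℝ → ℝ × ℝ
  σ (x , y) = (y , x)

  record PartialValuation (𝒜 : DMFAlgebra) : Set where
    open DMFAlgebra 𝒜 renaming (_≤_ to _≤A_)
    field
      v    : Carrier → ℝ × ℝ
      v∈T  : ∀ a → InT (v a)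
      v-𝟘  : v 𝟘 ≡ (0ℝ , 1ℝ)
      v-∨  : ∀ a b → v (a ∨ b) ≡ ((v a ⊕ v b) ⊖ v (a ∧ b))
      v-∼  : ∀ a → v (∼ a) ≡ σ (v a)
      v-n  : ∀ a → n ≤A a → (0ℝ , 0ℝ) ≼ v a

  Isotone : {𝒜 : DMFAlgebra} → PartialValuation 𝒜 → Set
  Isotone {𝒜} pv = ∀ a b → a ≤A b → v a ≼ v b
    where open DMFAlgebra 𝒜 renaming (_≤_ to _≤A_)
          open PartialValuation pv

-- The first coordinate v₁ of a partial valuation vanishes below n (for
-- a ≤ n we have n ≤ ∼ a, where v₂ vanishes), hence is additive on elements
-- whose meet is n. On ∇ a complement c of a gives
-- b = a ∨ (b ∧ c) with a ∧ (b ∧ c) = n whenever a ≤ b, so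
-- v₁ b = v₁ a + v₁ (b ∧ c) ≥ v₁ a. An arbitrary a ≤ b is moved into ∇ by
-- x ↦ x ∨ n, which does not change v₁. The second coordinate of v is the
-- first coordinate of v ∘ ∼, and ∼ is antitone.
module Submission where

open import Defs
open import Level using (0ℓ)
open import Data.Product using (_,_; proj₁; proj₂)
open import Relation.Binary.PropositionalEquality
  using (_≡_; sym; trans; cong; cong₂; subst; subst₂; module ≡-Reasoning)
open import Relation.Binary.Structures using (IsTotalOrder)
open import Algebra.Bundles using (CommutativeRing)
open import Algebra.Lattice.Bundles using (Lattice)
import Algebra.Lattice.Structures as LS
import Algebra.Lattice.Properties.Lattice as LatticeProperties
import Algebra.Properties.Ring as RingProperties

module DMFProperties (𝒜 : DMFAlgebra) where
  open DMFAlgebra 𝒜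
  open LS.IsDistributiveLattice isDistributiveLattice
    using (isLattice; ∨-comm; ∧-comm; ∧-assoc; ∨-absorbs-∧; ∧-absorbs-∨; ∨-distribˡ-∧; ∨-distribʳ-∧)
  open ≡-Reasoning

  lattice : Lattice 0ℓ 0ℓ
  lattice = record
    { Carrier = Carrier ; _≈_ = _≡_ ; _∨_ = _∨_ ; _∧_ = _∧_ ; isLattice = isLattice }

  open LatticeProperties lattice public using (∧-idem)

  ≤-refl : ∀ x → x ≤ x
  ≤-refl = ∧-idem

  x∧y≤y : ∀ x y → (x ∧ y) ≤ y
  x∧y≤y x y = begin
    (x ∧ y) ∧ y  ≡⟨ ∧-assoc x y y ⟩
    x ∧ (y ∧ y)  ≡⟨ cong (x ∧_) (∧-idem y) ⟩
    x ∧ y        ∎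

  y≤x∨y : ∀ x y → y ≤ (x ∨ y)
  y≤x∨y x y = trans (cong (y ∧_) (∨-comm x y)) (∧-absorbs-∨ y x)

  ≤⇒∨≡ : ∀ {x y} → x ≤ y → (x ∨ y) ≡ y
  ≤⇒∨≡ {x} {y} x≤y = begin
    x ∨ y        ≡⟨ cong (_∨ y) (trans (sym x≤y) (∧-comm x y)) ⟩
    (y ∧ x) ∨ y  ≡⟨ ∨-comm (y ∧ x) y ⟩
    y ∨ (y ∧ x)  ≡⟨ ∨-absorbs-∧ y x ⟩
    y            ∎

  ∨-monoˡ-≤ : ∀ {x y} z → x ≤ y → (x ∨ z) ≤ (y ∨ z)
  ∨-monoˡ-≤ {x} {y} z x≤y = trans (sym (∨-distribʳ-∧ z x y)) (cong (_∨ z) x≤y)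

  ∼-antitone : ∀ {x y} → x ≤ y → ∼ y ≤ ∼ x
  ∼-antitone {x} {y} x≤y = begin
    ∼ y ∧ ∼ x          ≡⟨ cong (λ z → ∼ y ∧ ∼ z) (sym x≤y) ⟩
    ∼ y ∧ ∼ (x ∧ y)    ≡⟨ cong (∼ y ∧_) (∼-deMorgan x y) ⟩
    ∼ y ∧ (∼ x ∨ ∼ y)  ≡⟨ cong (∼ y ∧_) (∨-comm (∼ x) (∼ y)) ⟩
    ∼ y ∧ (∼ y ∨ ∼ x)  ≡⟨ ∧-absorbs-∨ (∼ y) (∼ x) ⟩
    ∼ y                ∎

  ≤n⇒n≤∼ : ∀ {x} → x ≤ n → n ≤ ∼ x
  ≤n⇒n≤∼ x≤n = subst (_≤ _) ∼n≡n (∼-antitone x≤n)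

  ≤⇒∧-assoc : ∀ {x y} z → x ≤ y → (x ∧ (y ∧ z)) ≡ (x ∧ z)
  ≤⇒∧-assoc {x} {y} z x≤y = trans (sym (∧-assoc x y z)) (cong (_∧ z) x≤y)

  ≤⇒∨-relativeComplement : ∀ {x y z} → x ≤ y → (x ∨ z) ≡ 𝟙 → (x ∨ (y ∧ z)) ≡ y
  ≤⇒∨-relativeComplement {x} {y} {z} x≤y x∨z≡𝟙 = begin
    x ∨ (y ∧ z)        ≡⟨ ∨-distribˡ-∧ x y z ⟩
    (x ∨ y) ∧ (x ∨ z)  ≡⟨ cong₂ _∧_ (≤⇒∨≡ x≤y) x∨z≡𝟙 ⟩
    y ∧ 𝟙              ≡⟨ ∧-identityʳ y ⟩
    y                  ∎

module RealProperties (Rℝ : RealNumbers) where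
  open RealNumbers Rℝ

  commutativeRing : CommutativeRing 0ℓ 0ℓ
  commutativeRing = record { isCommutativeRing = isCommutativeRing }

  open CommutativeRing commutativeRing using (ring; +-identityˡ; +-comm)
  open CommutativeRing commutativeRing public using (+-identityʳ)
  open RingProperties ring using (-0#≈0#)

  x-0≡x : ∀ x → x - 0ℝ ≡ x
  x-0≡x x = trans (cong (x +_) -0#≈0#) (+-identityʳ x)

  x≤x+y : ∀ x {y} → 0ℝ ≤ y → x ≤ (x + y)
  x≤x+y x {y} 0≤y = subst₂ _≤_ (+-identityˡ x) (+-comm y x) (+-mono-≤ 0ℝ y x 0≤y)

module ValuationProperties (Rℝ : RealNumbers) {𝒜 : DMFAlgebra}
                           (pv : Pairs.PartialValuation Rℝ 𝒜) where
  open RealNumbers Rℝ renaming (_≤_ to _≤ℝ_)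
  open IsTotalOrder isTotalOrder using (antisym)
  open Pairs Rℝ
  open DMFAlgebra 𝒜
  open PartialValuation pv
  open DMFProperties 𝒜
  open RealProperties Rℝ
  open ≡-Reasoning

  v₁ v₂ : Carrier → ℝ
  v₁ a = proj₁ (v a)
  v₂ a = proj₂ (v a)

  v₁-∨ : ∀ a b → v₁ (a ∨ b) ≡ (v₁ a + v₁ b) - v₁ (a ∧ b)
  v₁-∨ a b = cong proj₁ (v-∨ a b)

  v₁∘∼ : ∀ a → v₁ (∼ a) ≡ v₂ a
  v₁∘∼ a = cong proj₁ (v-∼ a)

  v₂∘∼ : ∀ a → v₂ (∼ a) ≡ v₁ a
  v₂∘∼ a = cong proj₂ (v-∼ a)

  v₁-nonneg : ∀ a → 0ℝ ≤ℝ v₁ a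
  v₁-nonneg a = proj₁ (v∈T a)

  v₂-nonneg : ∀ a → 0ℝ ≤ℝ v₂ a
  v₂-nonneg a = proj₁ (proj₂ (proj₂ (v∈T a)))

  n≤⇒v₂≡0 : ∀ {a} → n ≤ a → v₂ a ≡ 0ℝ
  n≤⇒v₂≡0 {a} n≤a = antisym (proj₂ (v-n a n≤a)) (v₂-nonneg a)

  ≤n⇒v₁≡0 : ∀ {a} → a ≤ n → v₁ a ≡ 0ℝ
  ≤n⇒v₁≡0 {a} a≤n = trans (sym (v₂∘∼ a)) (n≤⇒v₂≡0 (≤n⇒n≤∼ a≤n))

  v₁-additive : ∀ {a b} → (a ∧ b) ≡ n → v₁ (a ∨ b) ≡ v₁ a + v₁ b
  v₁-additive {a} {b} a∧b≡n = begin
    v₁ (a ∨ b)                     ≡⟨ v₁-∨ a b ⟩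
    (v₁ a + v₁ b) - v₁ (a ∧ b)     ≡⟨ cong (λ x → (v₁ a + v₁ b) - x) (≤n⇒v₁≡0 a∧b≤n) ⟩
    (v₁ a + v₁ b) - 0ℝ             ≡⟨ x-0≡x (v₁ a + v₁ b) ⟩
    v₁ a + v₁ b                    ∎
    where
    a∧b≤n : (a ∧ b) ≤ n
    a∧b≤n = subst (_≤ n) (sym a∧b≡n) (≤-refl n)

  v₁-∨n : ∀ a → v₁ (a ∨ n) ≡ v₁ a
  v₁-∨n a = begin
    v₁ (a ∨ n)                     ≡⟨ v₁-∨ a n ⟩
    (v₁ a + v₁ n) - v₁ (a ∧ n)     ≡⟨ cong₂ (λ x y → (v₁ a + x) - y)
                                             (≤n⇒v₁≡0 (≤-refl n)) (≤n⇒v₁≡0 (x∧y≤y a n)) ⟩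
    (v₁ a + 0ℝ) - 0ℝ               ≡⟨ x-0≡x (v₁ a + 0ℝ) ⟩
    v₁ a + 0ℝ                      ≡⟨ +-identityʳ (v₁ a) ⟩
    v₁ a                           ∎

  v₁-mono-on-∇ : IntervalBoolean 𝒜 → ∀ {a b} → n ≤ a → a ≤ b → v₁ a ≤ℝ v₁ b
  v₁-mono-on-∇ IB {a} {b} n≤a a≤b with IB a n≤a
  ... | c , _ , a∧c≡n , a∨c≡𝟙 =
    subst (v₁ a ≤ℝ_) v₁-split (x≤x+y (v₁ a) (v₁-nonneg (b ∧ c)))
    where
    v₁-split : v₁ a + v₁ (b ∧ c) ≡ v₁ b
    v₁-split = begin
      v₁ a + v₁ (b ∧ c)  ≡⟨ v₁-additive (trans (≤⇒∧-assoc c a≤b) a∧c≡n) ⟨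
      v₁ (a ∨ (b ∧ c))   ≡⟨ cong v₁ (≤⇒∨-relativeComplement a≤b a∨c≡𝟙) ⟩
      v₁ b               ∎

  v₁-mono-via-∇ : (∀ {a b} → n ≤ a → a ≤ b → v₁ a ≤ℝ v₁ b) →
                  ∀ {a b} → a ≤ b → v₁ a ≤ℝ v₁ b
  v₁-mono-via-∇ mono∇ {a} {b} a≤b =
    subst₂ _≤ℝ_ (v₁-∨n a) (v₁-∨n b) (mono∇ (y≤x∨y a n) (∨-monoˡ-≤ n a≤b))

  v₁-mono⇒isotone : (∀ {a b} → a ≤ b → v₁ a ≤ℝ v₁ b) → Isotone pv
  v₁-mono⇒isotone v₁-mono a b a≤b =
    v₁-mono a≤b , subst₂ _≤ℝ_ (v₁∘∼ b) (v₁∘∼ a) (v₁-mono (∼-antitone a≤b))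

mainTheorem12 : (Rℝ : RealNumbers) (𝒜 : DMFAlgebra) → IntervalBoolean 𝒜 →
    (pv : Pairs.PartialValuation Rℝ 𝒜) → Pairs.Isotone Rℝ pv
mainTheorem12 Rℝ 𝒜 IB pv = v₁-mono⇒isotone (v₁-mono-via-∇ (v₁-mono-on-∇ IB))
  where open ValuationProperties Rℝ pv
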